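{- Let $a,b,c$ be pairwise coprime integers greater than $1$ with $a,b$ odd and $c$ even. Put $\alpha=\min\{\nu_2(a^2-1)-1,\nu_2(b^2-1)-1\}$ and $\beta=\nu_2(c)$. Let $(x,y,z)$ be a solution in positive integers of $a^x+b^y=c^z$. Then either $(\beta,z)=(1,1)$ or $\beta z\ge\alpha$.
   Context: $\nu_2(A)$ denotes the exponent of $2$ in the nonzero integer $A$. -}

module Defs where

open import Data.Nat using (ℕ; suc; _^_; _*_)
open import Data.Nat.Divisibility using (_∣_)
open import Data.Product using (_×_)
open import Relation.Nullary using (¬_)

IsNu2 : ℕ → ℕ → Set
IsNu2 n k = (2 ^ k ∣ n) × ¬ (2 ^ suc k ∣ n)

{-# OPTIONS --safe #-}
-- Let α = min(ν₂(a² − 1), ν₂(b² − 1)) − 1. As 2^(α+1) ∣ a² − 1 = 4u(u+1) for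
-- a = 2u + 1 and one of u, u + 1 is odd, a ≡ ±1 (mod 2^α); likewise b. Hence
-- c^z = a^x + b^y ≡ 0 or ±2 (mod 2^α). In the first case 2^α ∣ c^z, so
-- α ≤ ν₂(c^z) = βz; in the second, once α ≥ 2, c^z ≡ 2 (mod 4) forces βz = 1.
module Submission where

open import Defs
open import Data.Product using (_×_; _,_; ∃-syntax)
open import Data.Sum as Sum using (_⊎_; inj₁; inj₂; [_,_]′)
open import Function using (_∘_)
open import Relation.Nullary using (¬_; yes; no; contradiction)
open import Relation.Binary.PropositionalEquality
  using (_≡_; refl; sym; trans; cong; subst; subst₂)

module TwoAdic where

  open import Data.Nat
  open import Data.Nat.Properties
  open import Data.Nat.Divisibility
  open import Data.Nat.Primality using (Prime; prime[2]; prime⇒nonZero; ¬prime[1]; euclidsLemma)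
  open import Data.Nat.Tactic.RingSolver using (solve-∀)

  ^-monoʳ-∣ : ∀ b {m n} → m ≤ n → b ^ m ∣ b ^ n
  ^-monoʳ-∣ b {n = n} z≤n = 1∣ (b ^ n)
  ^-monoʳ-∣ b (s≤s m≤n) = *-monoʳ-∣ b (^-monoʳ-∣ b m≤n)

  prime^-divisor : ∀ {p n o} k → Prime p → p ∤ n → p ^ k ∣ n * o → p ^ k ∣ o
  prime^-divisor {o = o} zero _ _ _ = 1∣ o
  prime^-divisor {p} {n} {o} (suc k) pp p∤n p^[1+k]∣n*o
    with euclidsLemma n o pp (∣-trans (m∣m*n (p ^ k)) p^[1+k]∣n*o)
  ... | inj₁ p∣n = contradiction p∣n p∤n
  ... | inj₂ (divides q refl) = subst (p * p ^ k ∣_) (*-comm p q) (*-monoʳ-∣ p p^k∣q)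
    where
    instance _ = prime⇒nonZero pp
    p^k∣q : p ^ k ∣ q
    p^k∣q = prime^-divisor k pp p∤n (*-cancelˡ-∣ p (subst (p * p ^ k ∣_) (rearrange n q p) p^[1+k]∣n*o))
      where
      rearrange : ∀ n q p → n * (q * p) ≡ p * (n * q)
      rearrange = solve-∀

  prime^∣n*[1+n] : ∀ {p n} k → Prime p → p ^ k ∣ n * suc n → p ^ k ∣ n ⊎ p ^ k ∣ suc n
  prime^∣n*[1+n] {p} {n} k pp p^k∣n[1+n] with p ∣? n
  ... | no p∤n = inj₂ (prime^-divisor k pp p∤n p^k∣n[1+n])
  ... | yes p∣n = inj₁ (prime^-divisor k pp p∤1+n (subst (p ^ k ∣_) (*-comm n (suc n)) p^k∣n[1+n]))
    where
    p∤1+n : p ∤ suc n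
    p∤1+n p∣1+n = ¬prime[1] (subst Prime (∣1⇒≡1 (∣m+n∣m⇒∣n (subst (p ∣_) (+-comm 1 n) p∣1+n) p∣n)) pp)

  2∤⇒odd : ∀ {n} → 2 ∤ n → ∃[ u ] n ≡ suc (2 * u)
  2∤⇒odd {zero} 2∤0 = contradiction (2 ∣0) 2∤0
  2∤⇒odd {suc zero} _ = 0 , refl
  2∤⇒odd {suc (suc n)} 2∤2+n with 2∤⇒odd (2∤2+n ∘ ∣m∣n⇒∣m+n ∣-refl)
  ... | u , refl = suc u , cong (suc ∘ suc) (sym (+-suc u (u + 0)))

  odd-square-≡±1 : ∀ k {a} → 2 ∤ a → 2 ^ (2 + k) ∣ a * a ∸ 1 →
    2 ^ (1 + k) ∣ a ∸ 1 ⊎ 2 ^ (1 + k) ∣ a + 1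
  odd-square-≡±1 k 2∤a 2^[2+k]∣a²-1 with 2∤⇒odd 2∤a
  ... | u , refl with prime^∣n*[1+n] k prime[2] 2^k∣u[1+u]
    where
    square-pred : ∀ u → 2 * u + 2 * u * suc (2 * u) ≡ 2 * (2 * (u * suc u))
    square-pred = solve-∀
    2^k∣u[1+u] : 2 ^ k ∣ u * suc u
    2^k∣u[1+u] = *-cancelˡ-∣ 2 (*-cancelˡ-∣ 2 (subst (2 ^ (2 + k) ∣_) (square-pred u) 2^[2+k]∣a²-1))
  ... | inj₁ 2^k∣u = inj₁ (*-monoʳ-∣ 2 2^k∣u)
  ... | inj₂ 2^k∣1+u = inj₂ (subst (2 ^ (1 + k) ∣_) (double-suc u) (*-monoʳ-∣ 2 2^k∣1+u))
    where
    double-suc : ∀ u → 2 * suc u ≡ suc (2 * u) + 1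
    double-suc = solve-∀

  IsNu2⇒2^∣ : ∀ {n k m} → IsNu2 n k → m ≤ k → 2 ^ m ∣ n
  IsNu2⇒2^∣ (2^k∣n , _) m≤k = ∣-trans (^-monoʳ-∣ 2 m≤k) 2^k∣n

  IsNu2-maximal : ∀ {n k m} → IsNu2 n k → 2 ^ m ∣ n → m ≤ k
  IsNu2-maximal {n} {k} {m} (_ , 2^[1+k]∤n) 2^m∣n with m ≤? k
  ... | yes m≤k = m≤k
  ... | no m≰k = contradiction (∣-trans (^-monoʳ-∣ 2 (≰⇒> m≰k)) 2^m∣n) 2^[1+k]∤n

  IsNu2⇒odd-part : ∀ {n k} → IsNu2 n k → ∃[ d ] 2 ∤ d × n ≡ 2 ^ k * d
  IsNu2⇒odd-part {k = k} (divides d refl , 2^[1+k]∤n) =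
    d , 2^[1+k]∤n ∘ *-monoˡ-∣ (2 ^ k) , *-comm d (2 ^ k)

  odd-part⇒IsNu2 : ∀ {d} k → 2 ∤ d → IsNu2 (2 ^ k * d) k
  odd-part⇒IsNu2 {d} k 2∤d = m∣m*n d , 2∤d ∘ *-cancelˡ-∣ (2 ^ k) ∘ subst (_∣ 2 ^ k * d) (*-comm 2 (2 ^ k))
    where instance _ = m^n≢0 2 k

  IsNu2-* : ∀ {m n i j} → IsNu2 m i → IsNu2 n j → IsNu2 (m * n) (i + j)
  IsNu2-* {m} {n} {i} {j} νm νn with IsNu2⇒odd-part {m} {i} νm | IsNu2⇒odd-part {n} {j} νn
  ... | d , 2∤d , refl | e , 2∤e , refl =
    subst (λ t → IsNu2 t (i + j)) (sym regroup) (odd-part⇒IsNu2 (i + j) 2∤de)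
    where
    2∤de : 2 ∤ d * e
    2∤de 2∣de = [ 2∤d , 2∤e ]′ (euclidsLemma d e prime[2] 2∣de)
    swap-middle : ∀ x y d e → x * d * (y * e) ≡ x * y * (d * e)
    swap-middle = solve-∀
    regroup : 2 ^ i * d * (2 ^ j * e) ≡ 2 ^ (i + j) * (d * e)
    regroup = trans (swap-middle (2 ^ i) (2 ^ j) d e) (cong (_* (d * e)) (sym (^-distribˡ-+-* 2 i j)))

  IsNu2-^ : ∀ {n k} → IsNu2 n k → ∀ z → IsNu2 (n ^ z) (k * z)
  IsNu2-^ {k = k} _ zero = subst (IsNu2 1) (sym (*-zeroʳ k)) (odd-part⇒IsNu2 0 (>⇒∤ (s≤s (s≤s z≤n))))
  IsNu2-^ {n} {k} νn (suc z) =
    subst (IsNu2 (n * n ^ z)) (sym (*-suc k z)) (IsNu2-* {i = k} νn (IsNu2-^ {n} {k} νn z))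

module UnitsModuloPowersOfTwo where

  open import Data.Nat as ℕ using (ℕ; zero; suc; z≤n; s≤s)
  import Data.Nat.Properties as ℕ
  import Data.Nat.Divisibility as ℕ
  open import Data.Integer hiding (suc)
  open import Data.Integer.Properties using (+-identityʳ; pos-*)
  open import Data.Integer.Divisibility.Signed
  open import Data.Integer.Tactic.RingSolver using (solve-∀)
  open TwoAdic using (odd-square-≡±1; ^-monoʳ-∣)

  data IsUnit : ℤ → Set where
    one       : IsUnit 1ℤ
    minus-one : IsUnit -1ℤ

  IsUnit-* : ∀ {e f} → IsUnit e → IsUnit f → IsUnit (e * f)
  IsUnit-* one       one       = one
  IsUnit-* one       minus-one = minus-one
  IsUnit-* minus-one one       = minus-one
  IsUnit-* minus-one minus-one = one

  IsUnit-^ : ∀ {e} → IsUnit e → ∀ n → IsUnit (e ^ n)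
  IsUnit-^ _ zero        = one
  IsUnit-^ e-unit (suc n) = IsUnit-* e-unit (IsUnit-^ e-unit n)

  ∣m-n⇒∣m^k-n^k : ∀ {i m n} k → i ∣ m - n → i ∣ m ^ k - n ^ k
  ∣m-n⇒∣m^k-n^k {i} zero _ = ∣ᵤ⇒∣ (ℕ._∣0 ∣ i ∣)
  ∣m-n⇒∣m^k-n^k {i} {m} {n} (suc k) i∣m-n =
    subst (i ∣_) (sym (telescope m n (m ^ k) (n ^ k)))
      (∣m∣n⇒∣m+n (∣n⇒∣m*n m (∣m-n⇒∣m^k-n^k k i∣m-n)) (∣n⇒∣m*n (n ^ k) i∣m-n))
    where
    telescope : ∀ m n p q → m * p - n * q ≡ m * (p - q) + q * (m - n)
    telescope = solve-∀

  4∤2 : 4 ℕ.∤ 2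
  4∤2 = ℕ.>⇒∤ (s≤s (s≤s (s≤s z≤n)))

  unit-sum-dichotomy : ∀ {q e f} c → + 4 ∣ q → IsUnit e → IsUnit f → q ∣ c - (e + f) →
    (q ∣ c) ⊎ ¬ (+ 4 ∣ c)
  unit-sum-dichotomy _ 4∣q one one q∣c-2 =
    inj₂ λ 4∣c → 4∤2 (∣⇒∣ᵤ (∣m+n∣m⇒∣n (∣-trans 4∣q q∣c-2) 4∣c))
  unit-sum-dichotomy {q} c _ one minus-one q∣c = inj₁ (subst (q ∣_) (+-identityʳ c) q∣c)
  unit-sum-dichotomy {q} c _ minus-one one q∣c = inj₁ (subst (q ∣_) (+-identityʳ c) q∣c)
  unit-sum-dichotomy _ 4∣q minus-one minus-one q∣c+2 =
    inj₂ λ 4∣c → 4∤2 (∣⇒∣ᵤ (∣m+n∣m⇒∣n (∣-trans 4∣q q∣c+2) 4∣c))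

  pos-^ : ∀ m n → + (m ℕ.^ n) ≡ (+ m) ^ n
  pos-^ m zero    = refl
  pos-^ m (suc n) = trans (pos-* m (m ℕ.^ n)) (cong (+ m *_) (pos-^ m n))

  odd-≡±1 : ∀ k {a} → 2 ℕ.∤ a → 2 ℕ.^ (2 ℕ.+ k) ℕ.∣ a ℕ.* a ℕ.∸ 1 →
    ∃[ e ] IsUnit e × + (2 ℕ.^ (1 ℕ.+ k)) ∣ + a - e
  odd-≡±1 k {zero} 2∤0 _ = contradiction (2 ℕ.∣0) 2∤0
  odd-≡±1 k {suc a} 2∤a 2^[2+k]∣a²-1 with odd-square-≡±1 k 2∤a 2^[2+k]∣a²-1
  ... | inj₁ 2^[1+k]∣a-1 = 1ℤ , one , ∣ᵤ⇒∣ 2^[1+k]∣a-1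
  ... | inj₂ 2^[1+k]∣a+1 = -1ℤ , minus-one , ∣ᵤ⇒∣ 2^[1+k]∣a+1

  odd-power-sum-dichotomy : ∀ k {a b} x y → 2 ℕ.∤ a → 2 ℕ.∤ b →
    2 ℕ.^ (3 ℕ.+ k) ℕ.∣ a ℕ.* a ℕ.∸ 1 → 2 ℕ.^ (3 ℕ.+ k) ℕ.∣ b ℕ.* b ℕ.∸ 1 →
    (2 ℕ.^ (2 ℕ.+ k) ℕ.∣ a ℕ.^ x ℕ.+ b ℕ.^ y) ⊎ ¬ (4 ℕ.∣ a ℕ.^ x ℕ.+ b ℕ.^ y)
  odd-power-sum-dichotomy k {a} {b} x y 2∤a 2∤b 2^[3+k]∣a²-1 2^[3+k]∣b²-1
    with odd-≡±1 (suc k) 2∤a 2^[3+k]∣a²-1 | odd-≡±1 (suc k) 2∤b 2^[3+k]∣b²-1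
  ... | e , e-unit , q∣a-e | f , f-unit , q∣b-f =
    Sum.map ∣⇒∣ᵤ (λ 4∤ → 4∤ ∘ ∣ᵤ⇒∣)
      (unit-sum-dichotomy (+ (a ℕ.^ x ℕ.+ b ℕ.^ y)) 4∣q (IsUnit-^ e-unit x) (IsUnit-^ f-unit y) q∣sum)
    where
    q = + (2 ℕ.^ (2 ℕ.+ k))
    4∣q : + 4 ∣ q
    4∣q = ∣ᵤ⇒∣ (^-monoʳ-∣ 2 (ℕ.m≤m+n 2 k))
    interchange : ∀ m n o p → (m - o) + (n - p) ≡ (m + n) - (o + p)
    interchange = solve-∀
    q∣sum : q ∣ + (a ℕ.^ x ℕ.+ b ℕ.^ y) - (e ^ x + f ^ y)
    q∣sum = subst₂ (λ m n → q ∣ (m + n) - (e ^ x + f ^ y)) (sym (pos-^ a x)) (sym (pos-^ b y))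
      (subst (q ∣_) (interchange ((+ a) ^ x) ((+ b) ^ y) (e ^ x) (f ^ y))
        (∣m∣n⇒∣m+n (∣m-n⇒∣m^k-n^k x q∣a-e) (∣m-n⇒∣m^k-n^k y q∣b-f)))

open TwoAdic using (IsNu2⇒2^∣; IsNu2-maximal; IsNu2-^)
open UnitsModuloPowersOfTwo using (odd-power-sum-dichotomy)
open import Data.Nat using (ℕ; zero; suc; _+_; _*_; _∸_; _^_; _≤_; _<_; _⊓_; z≤n; s≤s)
open import Data.Nat.Properties using (m⊓n≤m; m⊓n≤n; *-mono-≤; ≮⇒≥; ≤-antisym; m*n≡1⇒m≡1; m*n≡1⇒n≡1)
open import Data.Nat.Coprimality using (Coprime)
open import Data.Nat.Divisibility using (_∣_)

suc≤∸1⇒suc< : ∀ {m} n → suc m ≤ n ∸ 1 → suc m < n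
suc≤∸1⇒suc< zero ()
suc≤∸1⇒suc< (suc n) = s≤s

lemma4p1 : (a b c x y z νa νb β : ℕ) →
    1 < a → 1 < b → 1 < c →
    Coprime a b → Coprime b c → Coprime a c →
    ¬ (2 ∣ a) → ¬ (2 ∣ b) → 2 ∣ c →
    IsNu2 (a * a ∸ 1) νa → IsNu2 (b * b ∸ 1) νb → IsNu2 c β →
    0 < x → 0 < y → 0 < z →
    a ^ x + b ^ y ≡ c ^ z →
    (β ≡ 1 × z ≡ 1) ⊎ ((νa ∸ 1) ⊓ (νb ∸ 1) ≤ β * z)
lemma4p1 a b c x y z νa νb β _ _ _ _ _ _ 2∤a 2∤b 2∣c νa-val νb-val β-val _ _ 0<z a^x+b^y≡c^z =
  bound ((νa ∸ 1) ⊓ (νb ∸ 1)) (m⊓n≤m _ _) (m⊓n≤n _ _)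
  where
  νc : IsNu2 (c ^ z) (β * z)
  νc = IsNu2-^ {k = β} β-val z
  1≤β : 1 ≤ β
  1≤β = IsNu2-maximal β-val 2∣c
  1≤βz : 1 ≤ β * z
  1≤βz = *-mono-≤ 1≤β 0<z
  bound : ∀ m → m ≤ νa ∸ 1 → m ≤ νb ∸ 1 → (β ≡ 1 × z ≡ 1) ⊎ (m ≤ β * z)
  bound zero _ _ = inj₂ z≤n
  bound (suc zero) _ _ = inj₂ 1≤βz
  bound (suc (suc k)) m≤νa∸1 m≤νb∸1
    with odd-power-sum-dichotomy k x y 2∤a 2∤b
           (IsNu2⇒2^∣ νa-val (suc≤∸1⇒suc< νa m≤νa∸1)) (IsNu2⇒2^∣ νb-val (suc≤∸1⇒suc< νb m≤νb∸1))
  ... | inj₁ 2^m∣a^x+b^y = inj₂ (IsNu2-maximal νc (subst (2 ^ (2 + k) ∣_) a^x+b^y≡c^z 2^m∣a^x+b^y))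
  ... | inj₂ 4∤a^x+b^y = inj₁ (m*n≡1⇒m≡1 β z βz≡1 , m*n≡1⇒n≡1 β z βz≡1)
    where
    βz≡1 : β * z ≡ 1
    βz≡1 = ≤-antisym (≮⇒≥ λ 1<βz → 4∤a^x+b^y (subst (4 ∣_) (sym a^x+b^y≡c^z) (IsNu2⇒2^∣ νc 1<βz))) 1≤βz
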